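{- Consider any call of Resample$(x,E)$ during an execution of the Forest-Algorithm, and let $Y$ be the set of all good atoms at the beginning of this call. If this call finishes, then all atoms in $Y\cup(\mathrm{supp}(E)\setminus S_x(E))$ are good.
   Context: Let $\Lambda$ be a finite set of atoms, $\{\psi_x\}_{x\in\Lambda}$ mutually independent random variables, $\psi_x$ with values in $\Psi_x$, and $\mathcal F$ a finite family of tempered events: each $E\in\mathcal F$ is determined by the variables indexed by a proper subset $\mathrm{supp}(E)\subsetneq\Lambda$. For each $E\in\mathcal F$ and $x\in\mathrm{supp}(E)$ a subset $S_x(E)\subsetneq\mathrm{supp}(E)$ with $x\notin S_x(E)$ is fixed (a seed of $E$ avoiding $x$, or $\emptyset$). Given an evaluation of the variables, an atom $x$ is bad if some event $E\in\mathcal F$ with $x\in\mathrm{supp}(E)$ occurs, and good otherwise. Total orders on $\Lambda$ and $\mathcal F$ are fixed. Forest-Algorithm: (1) sample all variables; (2) while there is a bad atom, let $x$ be the smallest bad atom and $E$ the smallest occurring event with $x\in\mathrm{supp}(E)$, and call Resample$(x,E)$; (3) output the current evaluation. Resample$(x,E)$: (1) resample all $\psi_y$ with $y\in\mathrm{supp}(E)\setminus S_x(E)$; (2) while there is a bad atom in $\mathrm{supp}(E)\setminus S_x(E)$, let $x'$ be the smallest such atom and $E'$ the smallest occurring event with $x'\in\mathrm{supp}(E')$, and call Resample$(x',E')$. -}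

module Defs where

open import Data.Nat using (ℕ)
open import Data.Fin using (Fin; _<_)
open import Data.Fin.Subset using (Subset; _∈_; _∉_; _⊂_; _─_; ⊤)
open import Data.Vec using (lookup)
open import Data.Bool using (Bool; true; false; if_then_else_)
open import Data.Product using (Σ; ∃; _×_)
open import Relation.Nullary using (¬_)
open import Relation.Binary.PropositionalEquality using (_≡_)

-- Atoms Λ = Fin n (the fixed total order on Λ is the order of Fin n),
-- events 𝓕 = Fin m (the fixed total order on 𝓕 is the order of Fin m).
record Setup : Set₁ where
  field
    n     : ℕ
    Ψ     : Fin n → Set                    -- value set of ψ_x
    m     : ℕ
    supp  : Fin m → Subset n
    occ   : Fin m → ((x : Fin n) → Ψ x) → Bool
    occ-det : ∀ E (σ τ : (x : Fin n) → Ψ x) →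
              (∀ y → y ∈ supp E → σ y ≡ τ y) → occ E σ ≡ occ E τ
    supp-proper : ∀ E → supp E ⊂ ⊤
    -- S E x = S_x(E), a proper subset of supp(E) not containing x (for x ∈ supp E)
    S     : Fin m → Fin n → Subset n
    S-proper : ∀ E x → x ∈ supp E → S E x ⊂ supp E
    S-avoid  : ∀ E x → x ∈ supp E → x ∉ S E x

module Alg (A : Setup) where
  open Setup A

  Atom : Set
  Atom = Fin n

  Ev : Set
  Ev = Fin m

  Eval : Set
  Eval = (x : Atom) → Ψ x

  R : Atom → Ev → Subset n
  R x E = supp E ─ S E x

  upd : Subset n → Eval → Eval → Eval
  upd P ρ σ y = if lookup P y then ρ y else σ y

  Bad : Eval → Atom → Set
  Bad σ x = ∃ λ E → x ∈ supp E × occ E σ ≡ true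

  Good : Eval → Atom → Set
  Good σ x = ¬ Bad σ x

  SmallestBad : Eval → Atom → Set
  SmallestBad σ x = Bad σ x × (∀ x' → x' < x → Good σ x')

  SmallestBadIn : Subset n → Eval → Atom → Set
  SmallestBadIn P σ x = x ∈ P × Bad σ x × (∀ x' → x' ∈ P → x' < x → Good σ x')

  SmallestOcc : Eval → Atom → Ev → Set
  SmallestOcc σ x E = x ∈ supp E × occ E σ ≡ true ×
                      (∀ E' → E' < E → x ∈ supp E' → occ E' σ ≡ false)

  mutual
    -- Res σ x E σ' : the call Resample(x,E) started in state σ finishes in state σ'
    -- (for some choice ρ of the resampled values, at every resampling step)
    data Res : Eval → Atom → Ev → Eval → Set where
      res : ∀ {σ x E σ'} (ρ : Eval) → Loop x E (upd (R x E) ρ σ) σ' → Res σ x E σ'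

    -- the while loop of Resample(x,E), run from state σ, exits in state σ'
    data Loop (x : Atom) (E : Ev) : Eval → Eval → Set where
      done : ∀ {σ} → (∀ y → y ∈ R x E → Good σ y) → Loop x E σ σ
      step : ∀ {σ σ₂ σ'} x' E' → SmallestBadIn (R x E) σ x' → SmallestOcc σ x' E' →
             Res σ x' E' σ₂ → Loop x E σ₂ σ' → Loop x E σ σ'

  -- MainReach σ : the main while loop of the Forest-Algorithm reaches its test in state σ
  data MainReach : Eval → Set where
    init : (σ : Eval) → MainReach σ
    step : ∀ {σ σ'} x E → MainReach σ → SmallestBad σ x → SmallestOcc σ x E →
           Res σ x E σ' → MainReach σ'

  mutual
    -- CallAt σ x E : during an execution, Resample(x,E) is called in state σ
    data CallAt : Eval → Atom → Ev → Set where
      top    : ∀ {σ x E} → MainReach σ → SmallestBad σ x → SmallestOcc σ x E → CallAt σ x E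
      nested : ∀ {σ x E x' E'} → InCall x E σ → SmallestBadIn (R x E) σ x' →
               SmallestOcc σ x' E' → CallAt σ x' E'

    -- InCall x E σ : during an execution, the while loop of some call
    -- Resample(x,E) reaches its test in state σ
    data InCall : Atom → Ev → Eval → Set where
      start : ∀ {σ x E} → CallAt σ x E → (ρ : Eval) → InCall x E (upd (R x E) ρ σ)
      step  : ∀ {σ σ₂ x E} x' E' → InCall x E σ → SmallestBadIn (R x E) σ x' →
              SmallestOcc σ x' E' → Res σ x' E' σ₂ → InCall x E σ₂

module Lemma2 (A : Setup) where
  open Setup A
  open Alg A
  open import Data.Sum using (_⊎_)

  Claim : Set
  Claim = ∀ {σ σ' : Eval} {x : Atom} {E : Ev} →
          CallAt σ x E → Res σ x E σ' →
          ∀ y → Good σ y ⊎ y ∈ R x E → Good σ' y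

-- The second half is immediate: the while loop of Resample(x,E) only exits
-- when no atom of supp(E) ∖ S_x(E) is bad.  For the first half we show that
-- a finishing call never makes an event occur that did not occur before
-- ("occurrence is reflected backwards").  Suppose F occurs at the end of the
-- call.  By induction over the nested calls, F already occurred right after
-- the initial resampling of supp(E) ∖ S_x(E).  At the end all atoms of
-- supp(E) ∖ S_x(E) are good, so supp(F) avoids that set; hence the initial
-- resampling did not touch the variables F depends on, and F occurred at the
-- start.  So a bad atom at the end was bad at the start.  None of this uses
-- the context in which the call is made, so the lemmas are stated for an
-- arbitrary finishing call.

module Submission where

open import Defs
open import Data.Fin.Subset using (Subset; _∈_; _∉_)
open import Data.Vec using (lookup)
open import Data.Vec.Properties using (lookup⇒[]=)
open import Data.Bool using (true; false)
open import Data.Product using (_,_)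
open import Data.Sum using (_⊎_; inj₁; inj₂)
open import Data.Empty using (⊥-elim)
open import Relation.Binary.PropositionalEquality using (_≡_; refl; sym; trans)

module Finished (A : Setup) where
  open Setup A
  open Alg A

  upd-outside : ∀ P ρ σ y → y ∉ P → upd P ρ σ y ≡ σ y
  upd-outside P ρ σ y y∉P with lookup P y in P[y]
  ... | true  = ⊥-elim (y∉P (lookup⇒[]= y P P[y]))
  ... | false = refl

  loop-exit-good : ∀ {x E τ σ'} → Loop x E τ σ' → ∀ y → y ∈ R x E → Good σ' y
  loop-exit-good (done allGood)        = allGood
  loop-exit-good (step _ _ _ _ _ rest) = loop-exit-good rest

  mutual
    res-reflects-occ : ∀ {σ x E σ'} → Res σ x E σ' →
                       ∀ F → occ F σ' ≡ true → occ F σ ≡ true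
    res-reflects-occ {σ} {x} {E} (res ρ loop) F F-occurs =
      trans (occ-det F σ (upd (R x E) ρ σ) untouched) (loop-reflects-occ loop F F-occurs)
      where
        -- an atom of supp(F) is bad at the end, so it lies outside
        -- supp(E) ∖ S_x(E) and was not resampled
        untouched : ∀ z → z ∈ supp F → σ z ≡ upd (R x E) ρ σ z
        untouched z z∈F = sym (upd-outside (R x E) ρ σ z
          (λ z∈R → loop-exit-good loop z z∈R (F , z∈F , F-occurs)))

    loop-reflects-occ : ∀ {x E τ σ'} → Loop x E τ σ' →
                        ∀ F → occ F σ' ≡ true → occ F τ ≡ true
    loop-reflects-occ (done _)                F F-occurs = F-occurs
    loop-reflects-occ (step _ _ _ _ call rest) F F-occurs =
      res-reflects-occ call F (loop-reflects-occ rest F F-occurs)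

  res-preserves-good : ∀ {σ x E σ'} → Res σ x E σ' → ∀ y → Good σ y → Good σ' y
  res-preserves-good call y y-good (F , y∈F , F-occurs) =
    y-good (F , y∈F , res-reflects-occ call F F-occurs)

  res-exit-good : ∀ {σ x E σ'} → Res σ x E σ' → ∀ y → y ∈ R x E → Good σ' y
  res-exit-good (res _ loop) = loop-exit-good loop

lemma2 : (A : Setup) → Lemma2.Claim A
lemma2 A _ call y (inj₁ y-good) = Finished.res-preserves-good A call y y-good
lemma2 A _ call y (inj₂ y∈R)    = Finished.res-exit-good A call y y∈R
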